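{- Let $p>3$ be a prime, and let $m(p)$ be the minimal integer $m$ such that there exist $2p$-element subsets $A_1,\ldots,A_m$ of $[4p]$ with the property that for every $2p$-element subset $B\subseteq[4p]$ there is some $i$ with $|A_i\cap B|=p$. Let $A_1,\ldots,A_{m(p)}$ be $2p$-element subsets of $[4p]$ having this property. Then there exists a subset $C\subseteq[4p]$ with $|C|=3p$ such that $|C\cap A_i|\not\equiv0\pmod p$ for each $1\le i\le m(p)$.
   Context: $[4p]=\{1,\ldots,4p\}$. -}

module Defs where

open import Data.Nat using (ℕ; _*_; _<_)
open import Data.Fin using (Fin)
open import Data.Fin.Subset using (Subset; _∩_; ∣_∣)
open import Data.Product using (∃-syntax; _×_)
open import Relation.Binary.PropositionalEquality using (_≡_)
open import Relation.Nullary using (¬_)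

IsFamily : (p m : ℕ) → (Fin m → Subset (4 * p)) → Set
IsFamily p m A = ∀ i → ∣ A i ∣ ≡ 2 * p

Covers : (p m : ℕ) → (Fin m → Subset (4 * p)) → Set
Covers p m A = ∀ (B : Subset (4 * p)) → ∣ B ∣ ≡ 2 * p → ∃[ i ] ∣ A i ∩ B ∣ ≡ p

IsMinCoverSize : (p m : ℕ) → Set
IsMinCoverSize p m =
  (∃[ A ] (IsFamily p m A × Covers p m A)) ×
  (∀ m' → m' < m → ∀ (A : Fin m' → Subset (4 * p)) → IsFamily p m' A → ¬ Covers p m' A)

-- Sliding a window of length 2p along [4p] changes its intersection with a 2p-set B by at most
-- one, and the windows starting at 1 and 2p + 1 partition [4p]; so some window meets B in exactly p
-- points and m(p) ≤ 2p + 1. The A_i and their complements are at most 4p + 2 < 2^p sets, each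
-- containing half of [4p], so repeatedly choosing a point that lies in half of the sets not yet hit
-- yields a p-set D meeting every A_i and every complement of an A_i. For C = ∁ D this gives
-- |C ∩ A_i| = p + |D ∖ A_i| with 0 < |D ∖ A_i| < p.

module Submission where

open import Defs
open import Data.Nat using (ℕ; _*_; _<_)
open import Data.Nat.Primality using (Prime)
open import Data.Nat.Divisibility using (_∣_)
open import Data.Fin using (Fin)
open import Data.Fin.Subset using (Subset; _∩_; ∣_∣)
open import Data.Product using (∃-syntax; _×_)
open import Relation.Binary.PropositionalEquality using (_≡_)
open import Relation.Nullary using (¬_)

open import Data.Nat.Properties
open import Algebra.Properties.CommutativeMonoid.Sum +-0-commutativeMonoid
  using (sum-syntax; sum-cong-≗; ∑-distrib-+)
open import Data.Bool using (Bool; true; false)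
open import Data.Fin using (zero; suc; toℕ; fromℕ<)
open import Data.Fin.Properties using (toℕ<n; toℕ-fromℕ<)
open import Data.Fin.Subset using (_∪_; ∁; ⁅_⁆; _⊆_; Nonempty; ⊤; ⊥; inside; outside)
open import Data.Fin.Subset.Properties
open import Data.List using (List; []; _∷_; length; filter; tabulate; _++_)
open import Data.List.Properties using (length-++; length-tabulate)
open import Data.List.Relation.Unary.All as All using (All; []; _∷_)
open import Data.List.Relation.Unary.All.Properties using (all-filter; filter⁺; filter⁻; ++⁺; ++⁻ˡ; ++⁻ʳ; tabulate⁺; tabulate⁻)
open import Data.Nat using (zero; suc; _+_; _∸_; _^_; _≤_; z≤n; s≤s; s≤s⁻¹; _≤?_; _≟_)
open import Data.Nat.Divisibility using (_∤_; ∣-refl; ∣m+n∣m⇒∣n; >⇒∤)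
open import Data.Nat.Primality using (prime?)
open import Data.Nat.Tactic.RingSolver using (solve-∀)
open import Data.Product using (_,_)
open import Data.Vec using ([]; _∷_)
open import Function using (_∘_)
open import Relation.Binary.PropositionalEquality using (refl; sym; trans; cong; cong₂; subst; module ≡-Reasoning)
open import Relation.Nullary using (yes; no; does; ¬?)
open import Relation.Nullary.Decidable using (from-no)
open import Relation.Nullary.Negation using (contradiction)
open import Relation.Unary using (Decidable)

iverson : Bool → ℕ
iverson true  = 1
iverson false = 0

length-filter-∷ : ∀ {a p} {A : Set a} {P : A → Set p} (P? : Decidable P) x xs →
  length (filter P? (x ∷ xs)) ≡ iverson (does (P? x)) + length (filter P? xs)
length-filter-∷ P? x xs with does (P? x)
... | true  = refl
... | false = refl

length-filter+length-filter-¬ : ∀ {a p} {A : Set a} {P : A → Set p} (P? : Decidable P) xs →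
  length (filter P? xs) + length (filter (¬? ∘ P?) xs) ≡ length xs
length-filter+length-filter-¬ P? [] = refl
length-filter+length-filter-¬ P? (x ∷ xs) with does (P? x)
... | true  = cong suc (length-filter+length-filter-¬ P? xs)
... | false = trans (+-suc _ _) (cong suc (length-filter+length-filter-¬ P? xs))

∣p∣≡∑∈ : ∀ {n} (p : Subset n) → ∣ p ∣ ≡ ∑[ x < n ] iverson (does (x ∈? p))
∣p∣≡∑∈ []            = refl
∣p∣≡∑∈ (inside  ∷ p) = cong suc (∣p∣≡∑∈ p)
∣p∣≡∑∈ (outside ∷ p) = ∣p∣≡∑∈ p

∃-≥-mean : ∀ {n} (f : Fin (suc n) → ℕ) → ∃[ x ] ∑[ y < suc n ] f y ≤ suc n * f x
∃-≥-mean {zero}  f = zero , ≤-refl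
∃-≥-mean {suc n} f with ∃-≥-mean (f ∘ suc)
... | x , ∑≤ with f zero ≤? f (suc x)
...   | yes f₀≤ = suc x , +-mono-≤ f₀≤ ∑≤
...   | no  f₀≰ = zero , +-monoʳ-≤ (f zero) (≤-trans ∑≤ (*-monoʳ-≤ (suc n) (<⇒≤ (≰⇒> f₀≰))))

degree : ∀ {n} → List (Subset n) → Fin n → ℕ
degree R x = length (filter (x ∈?_) R)

∑-degree-∷ : ∀ {n} (S : Subset n) R → ∑[ x < n ] degree (S ∷ R) x ≡ ∣ S ∣ + ∑[ x < n ] degree R x
∑-degree-∷ {n} S R = begin
  ∑[ x < n ] degree (S ∷ R) x                                    ≡⟨ sum-cong-≗ (λ x → length-filter-∷ (x ∈?_) S R) ⟩
  ∑[ x < n ] (iverson (does (x ∈? S)) + degree R x)              ≡⟨ ∑-distrib-+ _ (degree R) ⟩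
  ∑[ x < n ] iverson (does (x ∈? S)) + ∑[ x < n ] degree R x     ≡⟨ cong (_+ _) (sym (∣p∣≡∑∈ S)) ⟩
  ∣ S ∣ + ∑[ x < n ] degree R x                                  ∎
  where open ≡-Reasoning

AtLeastHalf : ∀ {n} → Subset n → Set
AtLeastHalf {n} S = n ≤ 2 * ∣ S ∣

n*length≤2*∑degree : ∀ {n} (R : List (Subset n)) → All AtLeastHalf R →
  n * length R ≤ 2 * ∑[ x < n ] degree R x
n*length≤2*∑degree {n} [] [] = ≤-trans (≤-reflexive (*-zeroʳ n)) z≤n
n*length≤2*∑degree {n} (S ∷ R) (large ∷ larges) = begin
  n * suc (length R)                       ≡⟨ *-suc n (length R) ⟩
  n + n * length R                         ≤⟨ +-mono-≤ large (n*length≤2*∑degree R larges) ⟩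
  2 * ∣ S ∣ + 2 * ∑[ x < n ] degree R x    ≡⟨ *-distribˡ-+ 2 ∣ S ∣ _ ⟨
  2 * (∣ S ∣ + ∑[ x < n ] degree R x)      ≡⟨ cong (2 *_) (∑-degree-∷ S R) ⟨
  2 * ∑[ x < n ] degree (S ∷ R) x          ∎
  where open ≤-Reasoning

popular-point : ∀ {n} (R : List (Subset (suc n))) → All AtLeastHalf R →
  ∃[ x ] length R ≤ 2 * degree R x
popular-point {n} R larges with ∃-≥-mean (degree R)
... | x , ∑≤ = x , *-cancelˡ-≤ (suc n) (begin
  suc n * length R                        ≤⟨ n*length≤2*∑degree R larges ⟩
  2 * ∑[ y < suc n ] degree R y           ≤⟨ *-monoʳ-≤ 2 ∑≤ ⟩
  2 * (suc n * degree R x)                ≡⟨ *-assoc 2 (suc n) (degree R x) ⟨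
  2 * suc n * degree R x                  ≡⟨ cong (_* degree R x) (*-comm 2 (suc n)) ⟩
  suc n * 2 * degree R x                  ≡⟨ *-assoc (suc n) 2 (degree R x) ⟩
  suc n * (2 * degree R x)                ∎)
  where open ≤-Reasoning

_meets_ : ∀ {n} → Subset n → Subset n → Set
p meets q = Nonempty (p ∩ q)

meets-monoˡ : ∀ {n} {p q r : Subset n} → p ⊆ q → p meets r → q meets r
meets-monoˡ {p = p} {r = r} p⊆q (x , x∈p∩r) with x∈p∩q⁻ p r x∈p∩r
... | x∈p , x∈r = x , x∈p∩q⁺ (p⊆q x∈p , x∈r)

∣p∪q∣≤∣p∣+∣q∣ : ∀ {n} (p q : Subset n) → ∣ p ∪ q ∣ ≤ ∣ p ∣ + ∣ q ∣
∣p∪q∣≤∣p∣+∣q∣ []            []            = z≤n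
∣p∪q∣≤∣p∣+∣q∣ (inside  ∷ p) (s       ∷ q) = s≤s (≤-trans (∣p∪q∣≤∣p∣+∣q∣ p q) (+-monoʳ-≤ ∣ p ∣ (∣p∣≤∣x∷p∣ s q)))
∣p∪q∣≤∣p∣+∣q∣ (outside ∷ p) (inside  ∷ q) = ≤-trans (s≤s (∣p∪q∣≤∣p∣+∣q∣ p q)) (≤-reflexive (sym (+-suc ∣ p ∣ ∣ q ∣)))
∣p∪q∣≤∣p∣+∣q∣ (outside ∷ p) (outside ∷ q) = ∣p∪q∣≤∣p∣+∣q∣ p q

halve-< : ∀ {a b c d} → b + a ≡ c → c ≤ 2 * b → c < 2 * d → a < d
halve-< {a} {b} {c} {d} b+a≡c c≤2b c<2d = *-cancelˡ-< 2 a d (≤-<-trans 2a≤c c<2d)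
  where
  2a≤c : 2 * a ≤ c
  2a≤c = +-cancelʳ-≤ c (2 * a) c (begin
    2 * a + c        ≤⟨ +-monoʳ-≤ (2 * a) c≤2b ⟩
    2 * a + 2 * b    ≡⟨ *-distribˡ-+ 2 a b ⟨
    2 * (a + b)      ≡⟨ cong (2 *_) (trans (+-comm a b) b+a≡c) ⟩
    2 * c            ≡⟨ cong (c +_) (+-identityʳ c) ⟩
    c + c            ∎)
    where open ≤-Reasoning

hitting-set : ∀ {n} k (R : List (Subset (suc n))) → All AtLeastHalf R →
  length R < 2 ^ k → ∃[ D ] ∣ D ∣ ≤ k × All (D meets_) R
hitting-set {n} zero [] _ _ = ⊥ , ≤-reflexive (∣⊥∣≡0 (suc n)) , []
hitting-set zero (_ ∷ _) _ (s≤s ())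
hitting-set (suc k) R larges R<2^k+1 with popular-point R larges
... | x , popular with hitting-set k (filter (¬? ∘ (x ∈?_)) R) (filter⁺ (¬? ∘ (x ∈?_)) larges)
                        (halve-< (length-filter+length-filter-¬ (x ∈?_) R) popular R<2^k+1)
... | D , ∣D∣≤k , meets-rest =
  D ∪ ⁅ x ⁆ , ∣D∪x∣≤k+1 , filter⁻ (x ∈?_) meets-through-x (All.map (meets-monoˡ (p⊆p∪q ⁅ x ⁆)) meets-rest)
  where
  ∣D∪x∣≤k+1 : ∣ D ∪ ⁅ x ⁆ ∣ ≤ suc k
  ∣D∪x∣≤k+1 = begin
    ∣ D ∪ ⁅ x ⁆ ∣         ≤⟨ ∣p∪q∣≤∣p∣+∣q∣ D ⁅ x ⁆ ⟩
    ∣ D ∣ + ∣ ⁅ x ⁆ ∣     ≤⟨ +-monoˡ-≤ _ ∣D∣≤k ⟩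
    k + ∣ ⁅ x ⁆ ∣         ≡⟨ cong (k +_) (∣⁅x⁆∣≡1 x) ⟩
    k + 1                 ≡⟨ +-comm k 1 ⟩
    suc k                 ∎
    where open ≤-Reasoning
  meets-through-x : All ((D ∪ ⁅ x ⁆) meets_) (filter (x ∈?_) R)
  meets-through-x = All.map (λ x∈S → x , x∈p∩q⁺ (q⊆p∪q D ⁅ x ⁆ (x∈⁅x⁆ x) , x∈S)) (all-filter (x ∈?_) R)

superset-of-size : ∀ {n} (p : Subset n) {k} → ∣ p ∣ ≤ k → k ≤ n → ∃[ q ] p ⊆ q × ∣ q ∣ ≡ k
superset-of-size []            {zero}  _ _ = [] , ⊆-refl , refl
superset-of-size (inside  ∷ p) {suc k} (s≤s ∣p∣≤k) (s≤s k≤n) with superset-of-size p ∣p∣≤k k≤n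
... | q , p⊆q , ∣q∣≡k = inside ∷ q , s⊆s p⊆q , cong suc ∣q∣≡k
superset-of-size (outside ∷ p) {zero}  ∣p∣≤0 _ = outside ∷ p , ⊆-refl , n≤0⇒n≡0 ∣p∣≤0
superset-of-size (outside ∷ p) {suc k} ∣p∣≤1+k (s≤s k≤n) with ∣ p ∣ ≟ suc k
... | yes ∣p∣≡1+k = outside ∷ p , ⊆-refl , ∣p∣≡1+k
... | no  ∣p∣≢1+k with superset-of-size p (s≤s⁻¹ (≤∧≢⇒< ∣p∣≤1+k ∣p∣≢1+k)) k≤n
...   | q , p⊆q , ∣q∣≡k = inside ∷ q , out⊆ p⊆q , cong suc ∣q∣≡k

∣p∣≡∣p∩q∣+∣p∩∁q∣ : ∀ {n} (p q : Subset n) → ∣ p ∣ ≡ ∣ p ∩ q ∣ + ∣ p ∩ ∁ q ∣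
∣p∣≡∣p∩q∣+∣p∩∁q∣ []            []            = refl
∣p∣≡∣p∩q∣+∣p∩∁q∣ (inside  ∷ p) (inside  ∷ q) = cong suc (∣p∣≡∣p∩q∣+∣p∩∁q∣ p q)
∣p∣≡∣p∩q∣+∣p∩∁q∣ (inside  ∷ p) (outside ∷ q) = trans (cong suc (∣p∣≡∣p∩q∣+∣p∩∁q∣ p q)) (sym (+-suc _ _))
∣p∣≡∣p∩q∣+∣p∩∁q∣ (outside ∷ p) (_       ∷ q) = ∣p∣≡∣p∩q∣+∣p∩∁q∣ p q

-- window n a l = {a, …, a + l - 1} (0-based, truncated to the n available positions)
window : ∀ n → ℕ → ℕ → Subset n
window zero    _       _       = []
window (suc n) zero    zero    = ⊥
window (suc n) zero    (suc l) = inside ∷ window n zero l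
window (suc n) (suc a) l       = outside ∷ window n a l

∣window∣≤ : ∀ n a l → ∣ window n a l ∣ ≤ l
∣window∣≤ zero    _       _       = z≤n
∣window∣≤ (suc n) zero    zero    = ≤-reflexive (∣⊥∣≡0 (suc n))
∣window∣≤ (suc n) zero    (suc l) = s≤s (∣window∣≤ n zero l)
∣window∣≤ (suc n) (suc a) l       = ∣window∣≤ n a l

∣window∣ : ∀ n a l → a + l ≤ n → ∣ window n a l ∣ ≡ l
∣window∣ zero    zero    zero    _         = refl
∣window∣ (suc n) zero    zero    _         = ∣⊥∣≡0 (suc n)
∣window∣ (suc n) zero    (suc l) (s≤s l≤n) = cong suc (∣window∣ n zero l l≤n)
∣window∣ (suc n) (suc a) l       (s≤s a+l≤n) = ∣window∣ n a l a+l≤n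

window-full : ∀ n → window n 0 n ≡ ⊤
window-full zero    = refl
window-full (suc n) = cong (inside ∷_) (window-full n)

∣window∩∣-+ : ∀ {n} (B : Subset n) a l₁ l₂ →
  ∣ window n a (l₁ + l₂) ∩ B ∣ ≡ ∣ window n a l₁ ∩ B ∣ + ∣ window n (a + l₁) l₂ ∩ B ∣
∣window∩∣-+ []            _       _        _  = refl
∣window∩∣-+ (_ ∷ B)       (suc a) l₁       l₂ = ∣window∩∣-+ B a l₁ l₂
∣window∩∣-+ {suc n} B     zero    zero     l₂ =
  cong (_+ ∣ window (suc n) 0 l₂ ∩ B ∣) (sym (trans (cong ∣_∣ (∩-zeroˡ B)) (∣⊥∣≡0 (suc n))))
∣window∩∣-+ (inside  ∷ B) zero    (suc l₁) l₂ = cong suc (∣window∩∣-+ B zero l₁ l₂)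
∣window∩∣-+ (outside ∷ B) zero    (suc l₁) l₂ = ∣window∩∣-+ B zero l₁ l₂

∣window∩∣-slide : ∀ {n} (B : Subset n) a l → ∣ window n (suc a) l ∩ B ∣ ≤ suc ∣ window n a l ∩ B ∣
∣window∩∣-slide {n} B a l = begin
  ∣ window n (suc a) l ∩ B ∣                              ≤⟨ m≤n+m _ _ ⟩
  ∣ window n a 1 ∩ B ∣ + ∣ window n (suc a) l ∩ B ∣       ≡⟨ cong (λ b → ∣ window n a 1 ∩ B ∣ + ∣ window n b l ∩ B ∣) (+-comm 1 a) ⟩
  ∣ window n a 1 ∩ B ∣ + ∣ window n (a + 1) l ∩ B ∣       ≡⟨ ∣window∩∣-+ B a 1 l ⟨
  ∣ window n a (suc l) ∩ B ∣                              ≡⟨ cong (λ j → ∣ window n a j ∩ B ∣) (+-comm 1 l) ⟩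
  ∣ window n a (l + 1) ∩ B ∣                              ≡⟨ ∣window∩∣-+ B a l 1 ⟩
  ∣ window n a l ∩ B ∣ + ∣ window n (a + l) 1 ∩ B ∣       ≤⟨ +-monoʳ-≤ _ (≤-trans (∣p∩q∣≤∣p∣ (window n (a + l) 1) B) (∣window∣≤ n (a + l) 1)) ⟩
  ∣ window n a l ∩ B ∣ + 1                                ≡⟨ +-comm _ 1 ⟩
  suc ∣ window n a l ∩ B ∣                                ∎
  where open ≤-Reasoning

discrete-ivt : (f : ℕ → ℕ) → (∀ k → f (suc k) ≤ suc (f k)) →
  ∀ {t} N → f 0 ≤ t → t ≤ f N → ∃[ k ] k ≤ N × f k ≡ t
discrete-ivt f step zero    f₀≤t t≤f₀ = 0 , z≤n , ≤-antisym f₀≤t t≤f₀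
discrete-ivt f step {t} (suc N) f₀≤t t≤fN+1 with t ≤? f N
... | yes t≤fN with discrete-ivt f step N f₀≤t t≤fN
...   | k , k≤N , fk≡t = k , m≤n⇒m≤1+n k≤N , fk≡t
discrete-ivt f step {t} (suc N) f₀≤t t≤fN+1 | no t≰fN =
  suc N , ≤-refl , ≤-antisym (≤-trans (step N) (≰⇒> t≰fN)) t≤fN+1

4*p≡2*p+2*p : ∀ p → 4 * p ≡ 2 * p + 2 * p
4*p≡2*p+2*p p = *-distribʳ-+ p 2 2

2*p≡p+p : ∀ p → 2 * p ≡ p + p
2*p≡p+p p = cong (p +_) (+-identityʳ p)

∣∁p∣≡ : ∀ {n a b} (S : Subset n) → a + b ≡ n → ∣ S ∣ ≡ a → ∣ ∁ S ∣ ≡ b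
∣∁p∣≡ {a = a} {b} S refl ∣S∣≡a = trans (∣∁p∣≡n∸∣p∣ S) (trans (cong (a + b ∸_) ∣S∣≡a) (m+n∸m≡n a b))

windows : ∀ p → Fin (suc (2 * p)) → Subset (4 * p)
windows p i = window (4 * p) (toℕ i) (2 * p)

∣window-4p∣ : ∀ p k → k ≤ 2 * p → ∣ window (4 * p) k (2 * p) ∣ ≡ 2 * p
∣window-4p∣ p k k≤2p = ∣window∣ (4 * p) k (2 * p) (≤-trans (+-monoˡ-≤ (2 * p) k≤2p) (≤-reflexive (sym (4*p≡2*p+2*p p))))

windows-family : ∀ p → IsFamily p (suc (2 * p)) (windows p)
windows-family p i = ∣window-4p∣ p (toℕ i) (s≤s⁻¹ (toℕ<n i))

module _ (p : ℕ) where

  private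
    hits : Subset (4 * p) → ℕ → ℕ
    hits B k = ∣ window (4 * p) k (2 * p) ∩ B ∣

  hits₀+hits₂ₚ≡∣B∣ : ∀ B → hits B 0 + hits B (2 * p) ≡ ∣ B ∣
  hits₀+hits₂ₚ≡∣B∣ B = begin
    hits B 0 + hits B (2 * p)                      ≡⟨ ∣window∩∣-+ B 0 (2 * p) (2 * p) ⟨
    ∣ window (4 * p) 0 (2 * p + 2 * p) ∩ B ∣       ≡⟨ cong (λ l → ∣ window (4 * p) 0 l ∩ B ∣) (4*p≡2*p+2*p p) ⟨
    ∣ window (4 * p) 0 (4 * p) ∩ B ∣               ≡⟨ cong (λ W → ∣ W ∩ B ∣) (window-full (4 * p)) ⟩
    ∣ ⊤ ∩ B ∣                                      ≡⟨ cong ∣_∣ (∩-identityˡ B) ⟩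
    ∣ B ∣                                          ∎
    where open ≡-Reasoning

  hits-complement : ∀ B k → k ≤ 2 * p → hits B k + hits (∁ B) k ≡ p + p
  hits-complement B k k≤2p =
    trans (sym (∣p∣≡∣p∩q∣+∣p∩∁q∣ (window (4 * p) k (2 * p)) B)) (trans (∣window-4p∣ p k k≤2p) (2*p≡p+p p))

  half-window-from-below : ∀ B → ∣ B ∣ ≡ 2 * p → hits B 0 ≤ p → ∃[ k ] k ≤ 2 * p × hits B k ≡ p
  half-window-from-below B ∣B∣≡2p h₀≤p =
    discrete-ivt (hits B) (λ k → ∣window∩∣-slide B k (2 * p)) (2 * p) h₀≤p p≤h₂ₚ
    where
    p≤h₂ₚ : p ≤ hits B (2 * p)
    p≤h₂ₚ = +-cancelˡ-≤ p p (hits B (2 * p)) (begin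
      p + p                           ≡⟨ 2*p≡p+p p ⟨
      2 * p                           ≡⟨ trans (sym ∣B∣≡2p) (sym (hits₀+hits₂ₚ≡∣B∣ B)) ⟩
      hits B 0 + hits B (2 * p)       ≤⟨ +-monoˡ-≤ _ h₀≤p ⟩
      p + hits B (2 * p)              ∎)
      where open ≤-Reasoning

  complement-hits₀≤p : ∀ B → p < hits B 0 → hits (∁ B) 0 ≤ p
  complement-hits₀≤p B p<h₀ = +-cancelˡ-≤ p (hits (∁ B) 0) p (begin
    p + hits (∁ B) 0            ≤⟨ +-monoˡ-≤ _ (<⇒≤ p<h₀) ⟩
    hits B 0 + hits (∁ B) 0     ≡⟨ hits-complement B 0 z≤n ⟩
    p + p                       ∎)
    where open ≤-Reasoning

  half-window : ∀ B → ∣ B ∣ ≡ 2 * p → ∃[ k ] k ≤ 2 * p × hits B k ≡ p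
  half-window B ∣B∣≡2p with hits B 0 ≤? p
  ... | yes h₀≤p = half-window-from-below B ∣B∣≡2p h₀≤p
  ... | no  h₀≰p with half-window-from-below (∁ B) (∣∁p∣≡ B (sym (4*p≡2*p+2*p p)) ∣B∣≡2p)
                       (complement-hits₀≤p B (≰⇒> h₀≰p))
  ...   | k , k≤2p , h̄ₖ≡p = k , k≤2p , +-cancelʳ-≡ p (hits B k) p
          (trans (cong (hits B k +_) (sym h̄ₖ≡p)) (hits-complement B k k≤2p))

  windows-cover : Covers p (suc (2 * p)) (windows p)
  windows-cover B ∣B∣≡2p with half-window B ∣B∣≡2p
  ... | k , k≤2p , hₖ≡p = fromℕ< (s≤s k≤2p) , subst (λ a → hits B a ≡ p) (sym (toℕ-fromℕ< (s≤s k≤2p))) hₖ≡p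

min-cover-size-≤ : ∀ {p m m'} → IsMinCoverSize p m →
  (A : Fin m' → Subset (4 * p)) → IsFamily p m' A → Covers p m' A → m ≤ m'
min-cover-size-≤ (_ , minimal) A family covers = ≮⇒≥ (λ m'<m → minimal _ m'<m A family covers)

p∤p+r : ∀ {p r} → 0 < r → r < p → p ∤ p + r
p∤p+r {r = suc _} _ r<p p∣p+r = >⇒∤ r<p (∣m+n∣m⇒∣n p∣p+r ∣-refl)

0<∣p∣ : ∀ {n} {p : Subset n} → Nonempty p → 0 < ∣ p ∣
0<∣p∣ (_ , x∈p) = ≤-<-trans z≤n (x∈p⇒∣p-x∣<∣p∣ x∈p)

∤-∣∁p∩q∣ : ∀ {n p} (D A : Subset n) → ∣ D ∣ ≡ p → ∣ A ∣ ≡ 2 * p →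
  D meets A → D meets ∁ A → p ∤ ∣ ∁ D ∩ A ∣
∤-∣∁p∩q∣ {p = p} D A ∣D∣≡p ∣A∣≡2p D∩A≢∅ D∩∁A≢∅ = subst (p ∤_) (sym c≡p+b) (p∤p+r (0<∣p∣ D∩∁A≢∅) b<p)
  where
  a = ∣ D ∩ A ∣
  b = ∣ D ∩ ∁ A ∣
  c = ∣ ∁ D ∩ A ∣
  a+b≡p : a + b ≡ p
  a+b≡p = trans (sym (∣p∣≡∣p∩q∣+∣p∩∁q∣ D A)) ∣D∣≡p
  a+c≡2p : a + c ≡ 2 * p
  a+c≡2p = trans (cong₂ _+_ (cong ∣_∣ (∩-comm D A)) (cong ∣_∣ (∩-comm (∁ D) A)))
                 (trans (sym (∣p∣≡∣p∩q∣+∣p∩∁q∣ A D)) ∣A∣≡2p)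
  c≡p+b : c ≡ p + b
  c≡p+b = +-cancelˡ-≡ a c (p + b) (begin
    a + c          ≡⟨ a+c≡2p ⟩
    2 * p          ≡⟨ 2*p≡p+p p ⟩
    p + p          ≡⟨ cong (_+ p) a+b≡p ⟨
    (a + b) + p    ≡⟨ +-assoc a b p ⟩
    a + (b + p)    ≡⟨ cong (a +_) (+-comm b p) ⟩
    a + (p + b)    ∎)
    where open ≡-Reasoning
  b<p : b < p
  b<p = subst (b <_) a+b≡p (m<n+m b (0<∣p∣ D∩A≢∅))

5≤p : ∀ {p} → Prime p → 3 < p → 5 ≤ p
5≤p 4-prime (s≤s (s≤s (s≤s (s≤s {n = zero}  z≤n)))) = contradiction 4-prime (from-no (prime? 4))
5≤p _       (s≤s (s≤s (s≤s (s≤s {n = suc _} z≤n)))) = s≤s (s≤s (s≤s (s≤s (s≤s z≤n))))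

4*p+2<2^p : ∀ {p} → 5 ≤ p → 4 * p + 2 < 2 ^ p
4*p+2<2^p (s≤s (s≤s (s≤s (s≤s (s≤s {n = q} z≤n))))) = bound q
  where
  step : ∀ q → 4 * (5 + suc q) + 2 ≡ 4 + (4 * (5 + q) + 2)
  step = solve-∀
  bound : ∀ q → 4 * (5 + q) + 2 < 2 ^ (5 + q)
  bound zero    = m≤m+n 23 9
  bound (suc q) = begin-strict
    4 * (5 + suc q) + 2            ≡⟨ step q ⟩
    4 + (4 * (5 + q) + 2)          <⟨ +-mono-< (<-trans (s≤s (s≤s (s≤s (s≤s (s≤s z≤n))))) (bound q)) (bound q) ⟩
    2 ^ (5 + q) + 2 ^ (5 + q)      ≡⟨ 2*p≡p+p (2 ^ (5 + q)) ⟨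
    2 ^ (5 + suc q)                ∎
    where open ≤-Reasoning

half-size⇒AtLeastHalf : ∀ p (S : Subset (4 * p)) → ∣ S ∣ ≡ 2 * p → AtLeastHalf S
half-size⇒AtLeastHalf p S ∣S∣≡2p = ≤-reflexive (trans (*-assoc 2 2 p) (cong (2 *_) (sym ∣S∣≡2p)))

halves : ∀ {n m} → (Fin m → Subset n) → List (Subset n)
halves A = tabulate A ++ tabulate (∁ ∘ A)

length-halves : ∀ {n m} (A : Fin m → Subset n) → length (halves A) ≡ m + m
length-halves A = trans (length-++ (tabulate A)) (cong₂ _+_ (length-tabulate A) (length-tabulate (∁ ∘ A)))

halves-AtLeastHalf : ∀ p {m} {A : Fin m → Subset (4 * p)} → IsFamily p m A → All AtLeastHalf (halves A)
halves-AtLeastHalf p {A = A} A-family =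
  ++⁺ (tabulate⁺ λ i → half-size⇒AtLeastHalf p (A i) (A-family i))
      (tabulate⁺ λ i → half-size⇒AtLeastHalf p (∁ (A i)) (∣∁p∣≡ (A i) (sym (4*p≡2*p+2*p p)) (A-family i)))

nonmultiple-3p-set : ∀ p m → m + m < 2 ^ p → (A : Fin m → Subset (4 * p)) → IsFamily p m A →
  ∃[ C ] ∣ C ∣ ≡ 3 * p × (∀ i → p ∤ ∣ C ∩ A i ∣)
nonmultiple-3p-set zero     zero    _ _ _ = [] , refl , λ ()
nonmultiple-3p-set zero     (suc _) (s≤s ()) _ _
nonmultiple-3p-set p@(suc _) m 2m<2^p A A-family =
  let D₀ , ∣D₀∣≤p , D₀-meets = hitting-set p (halves A) (halves-AtLeastHalf p A-family)
                                 (subst (_< 2 ^ p) (sym (length-halves A)) 2m<2^p)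
      D  , D₀⊆D  , ∣D∣≡p     = superset-of-size D₀ ∣D₀∣≤p (m≤m+n p (3 * p))
  in ∁ D , ∣∁p∣≡ D refl ∣D∣≡p , λ i → ∤-∣∁p∩q∣ D (A i) ∣D∣≡p (A-family i)
       (meets-monoˡ D₀⊆D (tabulate⁻ (++⁻ˡ (tabulate A) D₀-meets) i))
       (meets-monoˡ D₀⊆D (tabulate⁻ (++⁻ʳ (tabulate A) D₀-meets) i))

[2p+1]+[2p+1]≡4p+2 : ∀ p → suc (2 * p) + suc (2 * p) ≡ 4 * p + 2
[2p+1]+[2p+1]≡4p+2 = solve-∀

-- Only the size m(p) of the family is used, not its covering property.
proposition5p1 : (p : ℕ) → Prime p → 3 < p →
    (m : ℕ) → IsMinCoverSize p m →
    (A : Fin m → Subset (4 * p)) → IsFamily p m A → Covers p m A →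
    ∃[ C ] (∣ C ∣ ≡ 3 * p × (∀ i → ¬ (p ∣ ∣ C ∩ A i ∣)))
proposition5p1 p p-prime 3<p m m-minimal A A-family _ = nonmultiple-3p-set p m 2m<2^p A A-family
  where
  m≤2p+1 : m ≤ suc (2 * p)
  m≤2p+1 = min-cover-size-≤ m-minimal (windows p) (windows-family p) (windows-cover p)
  2m<2^p : m + m < 2 ^ p
  2m<2^p = begin-strict
    m + m                        ≤⟨ +-mono-≤ m≤2p+1 m≤2p+1 ⟩
    suc (2 * p) + suc (2 * p)    ≡⟨ [2p+1]+[2p+1]≡4p+2 p ⟩
    4 * p + 2                    <⟨ 4*p+2<2^p (5≤p p-prime 3<p) ⟩
    2 ^ p                        ∎
    where open ≤-Reasoning
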